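{- For any finite graph $G$ of order $n\ge 6$ with complement $\overline{G}$, $b(G)\,b(\overline{G})\le 2n$, and equality holds when $G$ is the complete graph $K_n$.
   Context: Graphs here need not be connected. Burning process on a finite graph: in round 1 one node is chosen and burned; in each round $t\ge 2$, every unburned neighbour of a node burned by the end of round $t-1$ becomes burned, and one additional unburned node (if available) is chosen and burned; burned nodes stay burned. The burning number $b(\cdot)$ is the minimum number of rounds needed until all nodes are burned. -}

module Defs where

open import Data.Nat using (ℕ; zero; suc; _<_)
open import Data.Fin using (Fin)
open import Data.Maybe using (Maybe; just; nothing)
open import Data.Product using (Σ; ∃; _×_; _,_)
open import Data.Sum using (_⊎_)
open import Data.Empty using (⊥)
open import Relation.Nullary using (¬_)
open import Relation.Binary.PropositionalEquality using (_≡_; _≢_; sym)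

record Graph (n : ℕ) : Set₁ where
  field
    Adj     : Fin n → Fin n → Set
    sym-adj : ∀ {u v} → Adj u v → Adj v u
    irrefl  : ∀ {u} → ¬ Adj u u
open Graph public

complement : ∀ {n} → Graph n → Graph n
complement G = record
  { Adj     = λ u v → (u ≢ v) × ¬ Adj G u v
  ; sym-adj = λ { (u≢v , ¬a) → (λ e → u≢v (sym e)) , (λ a → ¬a (sym-adj G a)) }
  ; irrefl  = λ { (u≢u , _) → u≢u Relation.Binary.PropositionalEquality.refl }
  }

complete : (n : ℕ) → Graph n
complete n = record
  { Adj     = λ u v → u ≢ v
  ; sym-adj = λ u≢v e → u≢v (sym e)
  ; irrefl  = λ u≢u → u≢u Relation.Binary.PropositionalEquality.refl
  }

-- A choice sequence: c t is the node chosen in round t+1 (nothing = no node chosen).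
Choices : ℕ → Set
Choices n = ℕ → Maybe (Fin n)

spread : ∀ {n} → Graph n → (Fin n → Set) → Fin n → Set
spread G B v = B v ⊎ (∃ λ u → Adj G u v × B u)

burned : ∀ {n} → Graph n → Choices n → ℕ → Fin n → Set
burned G c zero    v = ⊥
burned G c (suc t) v = spread G (burned G c t) v ⊎ (c t ≡ just v)

-- In round 1 nothing is burned yet, so a node must be chosen.
LegalChoice : ∀ {n} → Graph n → Choices n → ℕ → Set
LegalChoice G c t with c t
... | just x  = ¬ spread G (burned G c t) x
... | nothing = ∀ v → spread G (burned G c t) v

BurnsIn : ∀ {n} → Graph n → ℕ → Set
BurnsIn {n} G k = Σ (Choices n) λ c → (∀ t → t < k → LegalChoice G c t) × (∀ v → burned G c k v)

IsBurningNumber : ∀ {n} → Graph n → ℕ → Set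
IsBurningNumber G b = BurnsIn G b × (∀ k → k < b → ¬ BurnsIn G k)

-- If G has vertices u, w at distance ≥ 3, u is within two steps of everything
-- in Ḡ; otherwise every vertex of G is.  Call H the graph with such a vertex
-- (so b(H) ≤ 3) and H' the other.  An isolated vertex of H' dominates H, and
-- then b(H) ≤ 2, b(H') ≤ n.  Otherwise H' has no isolated vertex, and greedy
-- burning (an unburned vertex with an unburned neighbour, when possible) needs
-- only k = ⌊n/2⌋ + 1 rounds, with 3k ≤ 2n.  For K_n, two rounds are needed and
-- enough, and its edgeless complement needs n rounds, as nothing spreads.
module Submission where

open import Defs
open import Data.Nat using (ℕ; zero; suc; _≤_; _<_; _+_; _*_; _∸_; z≤n; s≤s; _≤?_)
open import Data.Nat.Properties
  using (≤-refl; ≤-trans; ≤-antisym; ≤-pred; ≮⇒≥; n≤1+n; m≤m+n; +-suc; *-suc;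
         +-mono-≤; *-mono-≤; *-comm; m+[n∸m]≡n)
open import Data.Fin using (Fin; zero; suc; toℕ; inject₁; fromℕ; _≟_)
open import Data.Fin.Properties using (0≢1+n; any?; all?; ¬∀⟶∃¬; injective⇒≤; toℕ-inject₁; toℕ-fromℕ)
open import Data.Fin.Subset using (Subset; _∈_; _∉_; _⊆_; _⊂_; _∪_; ⁅_⁆; ⊥; ∣_∣)
open import Data.Fin.Subset.Properties
  using (_∈?_; ∉⊥; ∈⊤; x∈⁅x⁆; x∈⁅y⁆⇒x≡y; x∈p∪q⁺; x∈p∪q⁻; ∣p∣≤n; ∣p∣≡n⇒p≡⊤;
         p⊆q⇒∣p∣≤∣q∣; p⊂q⇒∣p∣<∣q∣)
open import Data.Vec using (tabulate)
open import Data.Vec.Properties using (lookup∘tabulate; []=⇒lookup; lookup⇒[]=)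
open import Data.Bool using (true)
open import Data.Maybe using (Maybe; just; nothing)
open import Data.Maybe.Properties using (just-injective)
open import Data.Product using (Σ; ∃; ∃₂; _×_; _,_; proj₁; proj₂)
import Data.Product as Product
open import Data.Sum using (_⊎_; inj₁; inj₂; [_,_]; [_,_]′)
import Data.Sum as Sum
open import Data.Empty using (⊥-elim)
open import Function using (_∘_; id)
open import Function.Definitions using (Injective)
open import Relation.Nullary using (¬_; Dec; yes; no; does; ¬?)
open import Relation.Nullary.Decidable using (_×-dec_; _⊎-dec_; decidable-stable; ¬¬-excluded-middle; dec-true)
open import Relation.Binary.PropositionalEquality
  using (_≡_; _≢_; refl; sym; trans; cong; cong₂; subst; subst₂; ≢-sym)

DecidableAdjacency : ∀ {n} → Graph n → Set
DecidableAdjacency {n} G = (u v : Fin n) → Dec (Adj G u v)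

¬¬-∀-Fin : ∀ {n} {P : Fin n → Set} → (∀ x → ¬ ¬ P x) → ¬ ¬ (∀ x → P x)
¬¬-∀-Fin {zero}      _  k = k (λ ())
¬¬-∀-Fin {suc n} ¬¬P k =
  ¬¬P zero λ p₀ → ¬¬-∀-Fin (¬¬P ∘ suc) λ ps → k λ { zero → p₀ ; (suc x) → ps x }

-- Classically every finite graph has decidable adjacency; constructively this
-- holds under double negation, which is enough to prove decidable statements.
¬¬-decidable : ∀ {n} (G : Graph n) → ¬ ¬ DecidableAdjacency G
¬¬-decidable G = ¬¬-∀-Fin λ u → ¬¬-∀-Fin λ v → ¬¬-excluded-middle

fromDec : ∀ {n} {P : Fin n → Set} → ((v : Fin n) → Dec (P v)) → Subset n
fromDec P? = tabulate (λ v → does (P? v))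

does-true⇒ : ∀ {A : Set} (A? : Dec A) → does A? ≡ true → A
does-true⇒ (yes a) _ = a
does-true⇒ (no _) ()

∈fromDec⁺ : ∀ {n} {P : Fin n → Set} (P? : (v : Fin n) → Dec (P v)) {v} → P v → v ∈ fromDec P?
∈fromDec⁺ P? {v} p = lookup⇒[]= v _ (trans (lookup∘tabulate _ v) (dec-true (P? v) p))

∈fromDec⁻ : ∀ {n} {P : Fin n → Set} (P? : (v : Fin n) → Dec (P v)) {v} → v ∈ fromDec P? → P v
∈fromDec⁻ P? {v} v∈ = does-true⇒ (P? v) (trans (sym (lookup∘tabulate _ v)) ([]=⇒lookup v∈))

Complete : ∀ {n} → Subset n → Set
Complete {n} S = (v : Fin n) → v ∈ S

complete-if-large : ∀ {n} {S : Subset n} → n ≤ ∣ S ∣ → Complete S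
complete-if-large {S = S} n≤∣S∣ v =
  subst (v ∈_) (sym (∣p∣≡n⇒p≡⊤ (≤-antisym (∣p∣≤n S) n≤∣S∣))) ∈⊤

Near : ∀ {n} → Graph n → Fin n → Fin n → Set
Near H v x = x ≡ v ⊎ Adj H v x

Dominating : ∀ {n} → Graph n → Fin n → Set
Dominating H v = ∀ x → Near H v x

WithinTwo : ∀ {n} → Graph n → Fin n → Set
WithinTwo H v = ∀ x → Near H v x ⊎ ∃ λ y → Adj H v y × Adj H y x

Isolated : ∀ {n} → Graph n → Fin n → Set
Isolated H v = ∀ u → ¬ Adj H u v

Far : ∀ {n} → Graph n → Fin n → Fin n → Set
Far H u w = u ≢ w × ¬ Adj H u w × ¬ (∃ λ y → Adj H u y × Adj H y w)

complement? : ∀ {n} (G : Graph n) → DecidableAdjacency G → DecidableAdjacency (complement G)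
complement? G adj? u v = ¬? (u ≟ v) ×-dec ¬? (adj? u v)

far? : ∀ {n} (G : Graph n) → DecidableAdjacency G → Dec (∃₂ (Far G))
far? G adj? = any? λ u → any? λ w →
  ¬? (u ≟ w) ×-dec ¬? (adj? u w) ×-dec ¬? (any? λ y → adj? u y ×-dec adj? y w)

isolated⇒dominating-complement : ∀ {n} (G : Graph n) v → Isolated G v → Dominating (complement G) v
isolated⇒dominating-complement G v iso x with x ≟ v
... | yes x≡v = inj₁ x≡v
... | no  x≢v = inj₂ (≢-sym x≢v , λ a → iso x (sym-adj G a))

isolated-complement⇒dominating : ∀ {n} (G : Graph n) → DecidableAdjacency G →
  ∀ v → Isolated (complement G) v → Dominating G v
isolated-complement⇒dominating G adj? v iso x with x ≟ v | adj? v x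
... | yes x≡v | _    = inj₁ x≡v
... | no  _   | yes a = inj₂ a
... | no  x≢v | no ¬a = ⊥-elim (iso x (x≢v , λ a → ¬a (sym-adj G a)))

-- If u, w are far apart in G, then u reaches everything within two steps in
-- the complement: non-neighbours of u directly, neighbours of u through w.
far⇒withinTwo-complement : ∀ {n} (G : Graph n) → DecidableAdjacency G →
  ∀ {u w} → Far G u w → WithinTwo (complement G) u
far⇒withinTwo-complement G adj? {u} {w} (u≢w , ¬uw , ¬path) x with x ≟ u | adj? u x
... | yes x≡u | _    = inj₁ (inj₁ x≡u)
... | no  x≢u | no ¬a = inj₁ (inj₂ (≢-sym x≢u , ¬a))
... | no  _   | yes a =
  inj₂ (w , (u≢w , ¬uw) , (λ w≡x → ¬uw (subst (Adj G u) (sym w≡x) a)) ,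
             λ awx → ¬path (x , a , sym-adj G awx))

no-far⇒withinTwo : ∀ {n} (G : Graph n) → DecidableAdjacency G →
  ¬ ∃₂ (Far G) → ∀ u → WithinTwo G u
no-far⇒withinTwo G adj? noFar u x with x ≟ u | adj? u x | any? (λ y → adj? u y ×-dec adj? y x)
... | yes x≡u | _     | _       = inj₁ (inj₁ x≡u)
... | no  _   | yes a | _       = inj₁ (inj₂ a)
... | no  _   | no _  | yes path = inj₂ path
... | no  x≢u | no ¬a | no ¬path = ⊥-elim (noFar (u , x , ≢-sym x≢u , ¬a , ¬path))

burningNumber-≤ : ∀ {n} {H : Graph n} {b k} → IsBurningNumber H b → BurnsIn H k → b ≤ k
burningNumber-≤ (_ , minimal) burns = ≮⇒≥ (λ k<b → minimal _ k<b burns)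

spread-map : ∀ {n} (G : Graph n) {P Q : Fin n → Set} → (∀ {u} → P u → Q u) →
  ∀ {v} → spread G P v → spread G Q v
spread-map G f = Sum.map f (Product.map₂ (Product.map₂ f))

burned-round-one : ∀ {n} (H : Graph n) c {v} → burned H c 1 v → c 0 ≡ just v
burned-round-one H c (inj₁ (inj₁ ()))
burned-round-one H c (inj₁ (inj₂ (_ , _ , ())))
burned-round-one H c (inj₂ c₀≡v) = c₀≡v

two-rounds-needed : ∀ {m} (H : Graph (suc (suc m))) {k} → BurnsIn H k → 2 ≤ k
two-rounds-needed H {zero}          (_ , _ , all) = ⊥-elim (all zero)
two-rounds-needed H {suc zero}      (c , _ , all) =
  ⊥-elim (0≢1+n (just-injective (trans (sym (burned-round-one H c (all zero)))
                                            (burned-round-one H c (all (suc zero))))))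
two-rounds-needed H {suc (suc _)} _ = s≤s (s≤s z≤n)

Edgeless : ∀ {n} → Graph n → Set
Edgeless H = ∀ u v → ¬ Adj H u v

chosen-round : ∀ {n} {H : Graph n} → Edgeless H → ∀ {c} k {v} →
  burned H c k v → Σ (Fin k) λ i → c (toℕ i) ≡ just v
chosen-round noEdge {c} (suc k) (inj₁ (inj₁ b)) with chosen-round noEdge k b
... | i , cᵢ≡v = inject₁ i , subst (λ j → c j ≡ just _) (sym (toℕ-inject₁ i)) cᵢ≡v
chosen-round noEdge (suc k) (inj₁ (inj₂ (u , a , _))) = ⊥-elim (noEdge u _ a)
chosen-round noEdge {c} (suc k) (inj₂ cₖ≡v) =
  fromℕ k , subst (λ j → c j ≡ just _) (sym (toℕ-fromℕ k)) cₖ≡v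

-- An edgeless graph needs n rounds: distinct vertices are chosen in distinct rounds.
edgeless-needs-n : ∀ {n} {H : Graph n} → Edgeless H → ∀ {k} → BurnsIn H k → n ≤ k
edgeless-needs-n {n} noEdge {k} (c , _ , all) = injective⇒≤ round-injective
  where
  round : Fin n → Fin k
  round v = proj₁ (chosen-round noEdge k (all v))

  round-injective : Injective _≡_ _≡_ round
  round-injective {u} {v} same = just-injective
    (trans (sym (proj₂ (chosen-round noEdge k (all u))))
           (trans (cong (c ∘ toℕ) same) (proj₂ (chosen-round noEdge k (all v)))))

-- The burned
-- vertices are tracked as a subset; after round 1 the strategy burns an
-- unburned vertex with an unburned neighbour if there is one, otherwise any
-- unburned vertex.
module Greedy {n} (G : Graph n) (adj? : DecidableAdjacency G) (v₀ : Fin n) where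

  spread? : ∀ S v → Dec (spread G (_∈ S) v)
  spread? S v = (v ∈? S) ⊎-dec any? (λ u → adj? u v ×-dec (u ∈? S))

  Spread : Subset n → Subset n
  Spread S = fromDec (spread? S)

  ∈Spread⁺ : ∀ S {v} → spread G (_∈ S) v → v ∈ Spread S
  ∈Spread⁺ S = ∈fromDec⁺ (spread? S)

  ∈Spread⁻ : ∀ S {v} → v ∈ Spread S → spread G (_∈ S) v
  ∈Spread⁻ S = ∈fromDec⁻ (spread? S)

  ⊆Spread : ∀ S → S ⊆ Spread S
  ⊆Spread S v∈ = ∈Spread⁺ S (inj₁ v∈)

  ∉Spread⊥ : ∀ {v} → v ∉ Spread ⊥
  ∉Spread⊥ v∈ = [ ∉⊥ , (λ (_ , _ , u∈⊥) → ∉⊥ u∈⊥) ] (∈Spread⁻ ⊥ v∈)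

  mark : Maybe (Fin n) → Subset n
  mark (just x) = ⁅ x ⁆
  mark nothing  = ⊥

  ∈mark⁺ : ∀ {m v} → m ≡ just v → v ∈ mark m
  ∈mark⁺ {v = v} refl = x∈⁅x⁆ v

  ∈mark⁻ : ∀ m {v} → v ∈ mark m → m ≡ just v
  ∈mark⁻ (just x) v∈ = cong just (sym (x∈⁅y⁆⇒x≡y x v∈))
  ∈mark⁻ nothing  v∈ = ⊥-elim (∉⊥ v∈)

  next : Subset n → Maybe (Fin n) → Subset n
  next S m = Spread S ∪ mark m

  Spread⊆next : ∀ S m → Spread S ⊆ next S m
  Spread⊆next S m v∈ = x∈p∪q⁺ (inj₁ v∈)

  data Legal (S : Subset n) : Maybe (Fin n) → Set where
    fresh : ∀ {x} → x ∉ S → Legal S (just x)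
    none  : Complete S → Legal S nothing

  next-grows : ∀ S {x} → x ∉ Spread S → ∣ Spread S ∣ < ∣ next S (just x) ∣
  next-grows S {x} x∉ = p⊂q⇒∣p∣<∣q∣ (Spread⊆next S (just x) , x , x∈p∪q⁺ (inj₂ (x∈⁅x⁆ x)) , x∉)

  next-legal : ∀ S {m} → Legal (Spread S) m → Complete (next S m) ⊎ ∣ Spread S ∣ < ∣ next S m ∣
  next-legal S (fresh x∉) = inj₂ (next-grows S x∉)
  next-legal S (none all) = inj₁ (λ v → Spread⊆next S nothing (all v))

  data Move (S : Subset n) : Set where
    expand : ∀ x z → x ∉ S → Adj G x z → z ∉ S → Move S
    fill   : ∀ x → x ∉ S → (∀ {u w} → u ∉ S → Adj G u w → w ∈ S) → Move S
    stop   : Complete S → Move S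

  greedyMove : ∀ S → Move S
  greedyMove S with any? (λ x → ¬? (x ∈? S) ×-dec any? (λ z → adj? x z ×-dec ¬? (z ∈? S)))
  ... | yes (x , x∉ , z , a , z∉) = expand x z x∉ a z∉
  ... | no ¬expand with any? (λ x → ¬? (x ∈? S))
  ...   | yes (x , x∉) = fill x x∉ λ {u} {w} u∉ a →
            decidable-stable (w ∈? S) (λ w∉ → ¬expand (u , u∉ , w , a , w∉))
  ...   | no ¬unburned = stop λ v → decidable-stable (v ∈? S) (λ v∉ → ¬unburned (v , v∉))

  target : ∀ {S} → Move S → Maybe (Fin n)
  target (expand x _ _ _ _) = just x
  target (fill x _ _)       = just x
  target (stop _)           = nothing

  target-legal : ∀ {S} (mv : Move S) → Legal S (target mv)
  target-legal (expand _ _ x∉ _ _) = fresh x∉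
  target-legal (fill _ x∉ _)       = fresh x∉
  target-legal (stop all)          = none all

  strategy : ℕ → Subset n → Maybe (Fin n)
  strategy zero    _ = just v₀
  strategy (suc _) S = target (greedyMove S)

  state : ℕ → Subset n
  state zero    = ⊥
  state (suc t) = next (state t) (strategy t (Spread (state t)))

  choices : Choices n
  choices t = strategy t (Spread (state t))

  strategy-legal : ∀ t → Legal (Spread (state t)) (choices t)
  strategy-legal zero    = fresh ∉Spread⊥
  strategy-legal (suc t) = target-legal (greedyMove _)

  burned⇒∈state : ∀ t {v} → burned G choices t v → v ∈ state t
  burned⇒∈state (suc t) (inj₁ sp) =
    Spread⊆next (state t) (choices t) (∈Spread⁺ (state t) (spread-map G (burned⇒∈state t) sp))
  burned⇒∈state (suc t) (inj₂ eq) = x∈p∪q⁺ (inj₂ (∈mark⁺ eq))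

  ∈state⇒burned : ∀ t {v} → v ∈ state t → burned G choices t v
  ∈state⇒burned zero    v∈ = ∉⊥ v∈
  ∈state⇒burned (suc t) v∈ with x∈p∪q⁻ (Spread (state t)) _ v∈
  ... | inj₁ v∈Sp = inj₁ (spread-map G (∈state⇒burned t) (∈Spread⁻ (state t) v∈Sp))
  ... | inj₂ v∈mk = inj₂ (∈mark⁻ (choices t) v∈mk)

  legal : ∀ t → LegalChoice G choices t
  legal t with choices t | strategy-legal t
  ... | just x  | fresh x∉ = λ sp → x∉ (∈Spread⁺ (state t) (spread-map G (burned⇒∈state t) sp))
  ... | nothing | none all = λ v → spread-map G (∈state⇒burned t) (∈Spread⁻ (state t) (all v))

  burns-if-complete : ∀ k → Complete (state k) → BurnsIn G k
  burns-if-complete k all = choices , (λ t _ → legal t) , λ v → ∈state⇒burned k (all v)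

  state-mono : ∀ t → state t ⊆ state (suc t)
  state-mono t v∈ = Spread⊆next (state t) (choices t) (⊆Spread (state t) v∈)

  -- Every round burns a new vertex until all are burned, so n rounds suffice.
  counting : ∀ t → Complete (state t) ⊎ t ≤ ∣ state t ∣
  counting zero = inj₂ z≤n
  counting (suc t) with counting t | next-legal (state t) (strategy-legal t)
  ... | inj₁ all | _        = inj₁ (λ v → state-mono t (all v))
  ... | inj₂ _   | inj₁ all = inj₁ all
  ... | inj₂ t≤  | inj₂ grow =
    inj₂ (≤-trans (s≤s (≤-trans t≤ (p⊆q⇒∣p∣≤∣q∣ (⊆Spread (state t))))) grow)

  burns-in-n : BurnsIn G n
  burns-in-n = burns-if-complete n ([ id , complete-if-large ]′ (counting n))

  v₀∈state1 : v₀ ∈ state 1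
  v₀∈state1 = x∈p∪q⁺ (inj₂ (x∈⁅x⁆ v₀))

  near∈state2 : ∀ {x} → Near G v₀ x → x ∈ state 2
  near∈state2 (inj₁ refl) = state-mono 1 v₀∈state1
  near∈state2 (inj₂ a)    =
    Spread⊆next (state 1) (choices 1) (∈Spread⁺ (state 1) (inj₂ (v₀ , a , v₀∈state1)))

  burns-if-dominating : Dominating G v₀ → BurnsIn G 2
  burns-if-dominating dom = burns-if-complete 2 (near∈state2 ∘ dom)

  burns-if-withinTwo : WithinTwo G v₀ → BurnsIn G 3
  burns-if-withinTwo close = burns-if-complete 3 (reach ∘ close)
    where
    reach : ∀ {x} → Near G v₀ x ⊎ (∃ λ y → Adj G v₀ y × Adj G y x) → x ∈ state 3
    reach (inj₁ near)         = state-mono 2 (near∈state2 near)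
    reach (inj₂ (y , a , a′)) =
      Spread⊆next (state 2) (choices 2) (∈Spread⁺ (state 2) (inj₂ (y , a′ , near∈state2 (inj₂ a))))

  -- Spreading from S burns a new vertex, or burns everything.  While this
  -- holds, each greedy round burns at least two new vertices.
  Frontier : Subset n → Set
  Frontier S = S ⊂ Spread S ⊎ Complete (Spread S)

  module _ (noIsolated : ∀ v → ∃ λ u → Adj G u v) where

    greedy-round : ∀ S (mv : Move (Spread S)) →
      Complete (next S (target mv)) ⊎ (∣ Spread S ∣ < ∣ next S (target mv) ∣ × Frontier (next S (target mv)))
    greedy-round S (stop all) = inj₁ (λ v → Spread⊆next S nothing (all v))
    greedy-round S (expand x z x∉ a z∉) =
      inj₂ (next-grows S x∉ , inj₁ (⊆Spread N , z , ∈Spread⁺ N (inj₂ (x , a , x∈next)) , z∉next))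
      where
      N : Subset n
      N = next S (just x)

      x∈next : x ∈ N
      x∈next = x∈p∪q⁺ (inj₂ (x∈⁅x⁆ x))

      -- z is not the chosen vertex, since G has no loops
      z∉next : z ∉ N
      z∉next z∈ with x∈p∪q⁻ (Spread S) _ z∈
      ... | inj₁ z∈Sp = z∉ z∈Sp
      ... | inj₂ z∈x  = irrefl G (subst (Adj G x) (x∈⁅y⁆⇒x≡y x z∈x) a)
    greedy-round S (fill x x∉ closed) = inj₂ (next-grows S x∉ , inj₂ reach)
      where
      N : Subset n
      N = next S (just x)

      -- an unburned vertex has a neighbour, which cannot be unburned as well
      reach : Complete (Spread N)
      reach v with v ∈? Spread S
      ... | yes v∈ = ⊆Spread N (Spread⊆next S (just x) v∈)
      ... | no  v∉ with noIsolated v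
      ...   | u , a = ∈Spread⁺ N (inj₂ (u , a , Spread⊆next S (just x) u∈))
        where
        u∈ : u ∈ Spread S
        u∈ = decidable-stable (u ∈? Spread S) (λ u∉ → v∉ (closed u∉ a))

    HalfInvariant : ℕ → Set
    HalfInvariant t = Complete (state t) ⊎ (t + t ≤ suc ∣ state t ∣ × Frontier (state t))

    two-more : ∀ {a b c d} → a ≤ suc b → b < c → c < d → suc (suc a) ≤ suc d
    two-more a≤ b< c< = s≤s (≤-trans (s≤s a≤) (≤-trans (s≤s b<) c<))

    half-invariant : ∀ t → HalfInvariant (suc t)
    half-invariant zero with next-legal ⊥ (strategy-legal 0) | noIsolated v₀
    ... | inj₁ all | _ = inj₁ all
    ... | inj₂ grow | u , a =
      inj₂ (s≤s (≤-trans (s≤s z≤n) grow) , inj₁ (⊆Spread (state 1) , u , u∈ , u∉))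
      where
      u∈ : u ∈ Spread (state 1)
      u∈ = ∈Spread⁺ (state 1) (inj₂ (v₀ , sym-adj G a , v₀∈state1))

      u∉ : u ∉ state 1
      u∉ u∈state1 with x∈p∪q⁻ (Spread ⊥) _ u∈state1
      ... | inj₁ u∈Sp⊥ = ∉Spread⊥ u∈Sp⊥
      ... | inj₂ u∈v₀  = irrefl G (subst (λ y → Adj G y v₀) (x∈⁅y⁆⇒x≡y v₀ u∈v₀) a)
    half-invariant (suc t) with half-invariant t
    ... | inj₁ all              = inj₁ (λ v → state-mono (suc t) (all v))
    ... | inj₂ (_ , inj₂ allSp) =
      inj₁ (λ v → Spread⊆next (state (suc t)) (choices (suc t)) (allSp v))
    ... | inj₂ (bound , inj₁ S⊂) with greedy-round (state (suc t)) (greedyMove (Spread (state (suc t))))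
    ...   | inj₁ all        = inj₁ all
    ...   | inj₂ (grow , fr) =
            inj₂ (subst (_≤ suc ∣ state (suc (suc t)) ∣) (sym (cong suc (+-suc (suc t) (suc t))))
                        (two-more bound (p⊂q⇒∣p∣<∣q∣ S⊂) grow) , fr)

    burns-in-half : ∀ k → n < k + k → BurnsIn G k
    burns-in-half zero ()
    burns-in-half (suc t) n<2k with half-invariant t
    ... | inj₁ all        = burns-if-complete (suc t) all
    ... | inj₂ (bound , _) =
      burns-if-complete (suc t) (complete-if-large (≤-pred (≤-trans n<2k bound)))

-- k rounds are few enough for the product bound (3k ≤ 2n) and enough to
-- burn a graph without isolated vertices (n < 2k).
HalfRounds : ℕ → Set
HalfRounds n = ∃ λ k → n < k + k × 3 * k ≤ 2 * n

-- For n ≥ 6, k = ⌊n/2⌋ + 1 works; passing from n to n + 2 increases k by one.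
half-rounds-from-6 : ∀ m → HalfRounds (6 + m)
half-rounds-from-6 zero          = 4 , n≤1+n 7 , ≤-refl
half-rounds-from-6 (suc zero)    = 4 , ≤-refl , m≤m+n 12 2
half-rounds-from-6 (suc (suc m)) with half-rounds-from-6 m
... | k , n<2k , 3k≤2n = suc k , n+2<2k+2 , 3k+3≤2n+4
  where
  n+2<2k+2 : 8 + m < suc k + suc k
  n+2<2k+2 = subst (8 + m <_) (sym (cong suc (+-suc k k))) (s≤s (s≤s n<2k))

  3k+3≤2n+4 : 3 * suc k ≤ 2 * (8 + m)
  3k+3≤2n+4 = subst₂ _≤_ (sym (*-suc 3 k))
                (sym (trans (*-suc 2 (7 + m)) (cong (2 +_) (*-suc 2 (6 + m)))))
                (+-mono-≤ (n≤1+n 3) 3k≤2n)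

half-rounds : ∀ {n} → 6 ≤ n → HalfRounds n
half-rounds {n} 6≤n = subst HalfRounds (m+[n∸m]≡n 6≤n) (half-rounds-from-6 (n ∸ 6))

product-bound : ∀ {n} (H H' : Graph n) → DecidableAdjacency H → DecidableAdjacency H' →
  (∀ v → Isolated H' v → Dominating H v) → ∀ x → WithinTwo H x → HalfRounds n →
  ∀ {b b'} → IsBurningNumber H b → IsBurningNumber H' b' → b * b' ≤ 2 * n
product-bound {n} H H' adj? adj?' iso⇒dom x close (k , n<2k , 3k≤2n) {b} {b'} hb hb'
  with all? (λ v → any? (λ u → adj?' u v))
... | yes noIsolated = ≤-trans (*-mono-≤ b≤3 b'≤k) 3k≤2n
  where
  b≤3 : b ≤ 3
  b≤3 = burningNumber-≤ hb (Greedy.burns-if-withinTwo H adj? x close)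

  b'≤k : b' ≤ k
  b'≤k = burningNumber-≤ hb' (Greedy.burns-in-half H' adj?' x noIsolated k n<2k)
... | no ¬noIsolated with ¬∀⟶∃¬ n _ (λ v → any? (λ u → adj?' u v)) ¬noIsolated
...   | v , isolated = *-mono-≤ b≤2 b'≤n
  where
  b≤2 : b ≤ 2
  b≤2 = burningNumber-≤ hb (Greedy.burns-if-dominating H adj? v (iso⇒dom v (λ u a → isolated (u , a))))

  b'≤n : b' ≤ n
  b'≤n = burningNumber-≤ hb' (Greedy.burns-in-n H' adj?' v)

upper-bound-decidable : ∀ {n} → 6 ≤ n → (G : Graph n) → DecidableAdjacency G →
  ∀ {b b'} → IsBurningNumber G b → IsBurningNumber (complement G) b' → b * b' ≤ 2 * n
upper-bound-decidable {suc m} 6≤n G adj? {b} {b'} hb hb' with far? G adj?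
... | yes (u , w , far) =
  subst (_≤ 2 * suc m) (*-comm b' b)
    (product-bound (complement G) G (complement? G adj?) adj? (isolated⇒dominating-complement G)
                   u (far⇒withinTwo-complement G adj? far) (half-rounds 6≤n) hb' hb)
... | no noFar =
  product-bound G (complement G) adj? (complement? G adj?) (isolated-complement⇒dominating G adj?)
                zero (no-far⇒withinTwo G adj? noFar zero) (half-rounds 6≤n) hb hb'

complete-dominating : ∀ {n} (v : Fin n) → Dominating (complete n) v
complete-dominating v x with x ≟ v
... | yes x≡v = inj₁ x≡v
... | no  x≢v = inj₂ (≢-sym x≢v)

complete-graph-case : ∀ {n} → 2 ≤ n → ∀ {b b'} → IsBurningNumber (complete n) b →
  IsBurningNumber (complement (complete n)) b' → b * b' ≡ 2 * n
complete-graph-case {suc zero} (s≤s ())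
complete-graph-case {suc (suc m)} _ {b} {b'} hb hb' = cong₂ _*_ b≡2 b'≡n
  where
  K : Graph (suc (suc m))
  K = complete (suc (suc m))

  adj? : DecidableAdjacency K
  adj? u v = ¬? (u ≟ v)

  b≡2 : b ≡ 2
  b≡2 = ≤-antisym (burningNumber-≤ hb (Greedy.burns-if-dominating K adj? zero (complete-dominating zero)))
                  (two-rounds-needed K (proj₁ hb))

  b'≡n : b' ≡ suc (suc m)
  b'≡n = ≤-antisym (burningNumber-≤ hb' (Greedy.burns-in-n (complement K) (complement? K adj?) zero))
                   (edgeless-needs-n (λ u v (u≢v , ¬u≢v) → ¬u≢v u≢v) (proj₁ hb'))

theorem21 : (n : ℕ) → 6 ≤ n →
    ((G : Graph n) → (b b' : ℕ) → IsBurningNumber G b → IsBurningNumber (complement G) b' → b * b' ≤ 2 * n)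
    × ((b b' : ℕ) → IsBurningNumber (complete n) b → IsBurningNumber (complement (complete n)) b' → b * b' ≡ 2 * n)
theorem21 n 6≤n = upper , λ b b' → complete-graph-case {n} (≤-trans (s≤s (s≤s z≤n)) 6≤n) {b} {b'}
  where
  -- the bound is decidable, so decidability of adjacency may be assumed
  upper : (G : Graph n) → (b b' : ℕ) → IsBurningNumber G b → IsBurningNumber (complement G) b' → b * b' ≤ 2 * n
  upper G b b' hb hb' = decidable-stable (b * b' ≤? 2 * n) λ ¬bound →
    ¬¬-decidable G λ adj? → ¬bound (upper-bound-decidable 6≤n G adj? hb hb')
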